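{- Let $\Gamma$ be the Coxeter graph of an FC-finite Coxeter group and let $s$ be a vertex of $\Gamma$ of degree strictly greater than $1$. Then there is at most one vertex $t$ adjacent to $s$ such that $\Gamma_{s\to t}$ is not of type $A_n$ for some $n\geq 2$.
   Context: A Coxeter group $(W,S)$ is the group generated by a finite set $S$ with relations $(st)^{m(s,t)}=1$, $m(s,s)=1$, $2\leq m(s,t)=m(t,s)\leq\infty$ for $s\neq t$. Its Coxeter graph has vertex set $S$, with distinct $s,t$ joined by an edge labelled $m(s,t)$ iff $m(s,t)\geq3$. A graph is of type $A_n$ if it is a path on $n$ vertices with every edge labelled $3$. Let $\mathcal{C}$ be the relation $s\,\mathcal{C}\,t$ iff $m(s,t)\neq2$. A heap of a fully commutative element is a finite poset $(E,\leq)$ with a map $\varepsilon:E\to S$ such that elements with $\mathcal{C}$-related labels are comparable, $\leq$ is the transitive closure of the relation ($x\leq y$ and $\varepsilon(x)\,\mathcal{C}\,\varepsilon(y)$), there is no convex chain $\alpha_1<\cdots<\alpha_m$ with labels alternating $s,t,s,\ldots$ where $3\leq m=m(s,t)<\infty$, and there is no covering relation $\alpha<\beta$ with $\varepsilon(\alpha)=\varepsilon(\beta)$ (considered up to label-preserving isomorphism). The Coxeter group is FC-finite if there are finitely many such heaps (equivalently finitely many fully commutative elements). For adjacent vertices $s,t$ of $\Gamma$, let $\Gamma_{s,t}$ be the connected component containing $t$ of the graph obtained from $\Gamma$ by deleting $s$ and its edges, and $\Gamma_{s\to t}$ the full (labelled) subgraph of $\Gamma$ on $\{s\}$ together with the vertices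 of $\Gamma_{s,t}$. -}

module Defs where

open import Level using (0ℓ)
open import Data.Bool using (Bool; true; false; T; if_then_else_)
open import Data.Nat using (ℕ; zero; suc; _≤_; _<_; _≡ᵇ_; _≤ᵇ_; _%_; _∸_)
open import Data.Fin using (Fin; toℕ)
open import Data.List using (List; length; filterᵇ)
open import Data.List.Relation.Unary.Any using (Any)
open import Data.Product using (Σ; ∃; _×_; _,_)
open import Data.Sum using (_⊎_)
open import Data.Empty using (⊥)
open import Relation.Nullary using (¬_)
open import Relation.Binary.PropositionalEquality using (_≡_; _≢_)
open import Relation.Binary.Structures using (IsPartialOrder)
open import Relation.Binary.Construct.Closure.Transitive using (TransClosure)
open import Data.List.Base using (allFin)

data Label : Set where
  fin : ℕ → Label
  ∞   : Label

record CoxeterMatrix (n : ℕ) : Set where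
  field
    m    : Fin n → Fin n → Label
    sym  : ∀ s t → m s t ≡ m t s
    diag : ∀ s → m s s ≡ fin 1
    off  : ∀ s t → s ≢ t → m s t ≡ ∞ ⊎ Σ ℕ (λ k → m s t ≡ fin k × 2 ≤ k)
open CoxeterMatrix public

isEdge : Label → Bool
isEdge (fin k) = 3 ≤ᵇ k
isEdge ∞       = true

module _ {n : ℕ} (M : CoxeterMatrix n) where

  Adj : Fin n → Fin n → Set
  Adj s t = T (isEdge (m M s t))

  degree : Fin n → ℕ
  degree s = length (filterᵇ (λ t → isEdge (m M s t)) (allFin n))

  𝒞 : Fin n → Fin n → Set
  𝒞 s t = m M s t ≢ fin 2

  alt : {k : ℕ} → Fin n → Fin n → Fin k → Fin n
  alt s t i = if (toℕ i % 2) ≡ᵇ 0 then s else t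

  -- heaps of fully commutative elements (on the carrier Fin size)
  record Heap : Set₁ where
    field
      size : ℕ
      _≼_  : Fin size → Fin size → Set
      ε    : Fin size → Fin n
      isPO : IsPartialOrder _≡_ _≼_
    _≺_ : Fin size → Fin size → Set
    x ≺ y = x ≼ y × x ≢ y
    R : Fin size → Fin size → Set
    R x y = x ≼ y × 𝒞 (ε x) (ε y)
    field
      comparable : ∀ x y → 𝒞 (ε x) (ε y) → x ≼ y ⊎ y ≼ x
      closure⇒   : ∀ x y → x ≼ y → TransClosure R x y
      closure⇐   : ∀ x y → TransClosure R x y → x ≼ y
      noConvexChain :
        ∀ (s t : Fin n) (k : ℕ) → m M s t ≡ fin k → 3 ≤ k →
        (α : Fin k → Fin size) →
        (∀ (i j : Fin k) → toℕ j ≡ suc (toℕ i) → α i ≺ α j) →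
        (∀ i → ε (α i) ≡ alt s t i) →
        (∀ x → (Σ (Fin k) λ i → α i ≼ x) → (Σ (Fin k) λ j → x ≼ α j) →
               Σ (Fin k) λ l → α l ≡ x) →
        ⊥
      noCover : ∀ x y → x ≺ y → (∀ z → x ≼ z → z ≼ y → z ≡ x ⊎ z ≡ y) →
                ε x ≢ ε y

  record _≅_ (H H′ : Heap) : Set where
    private
      module H  = Heap H
      module H′ = Heap H′
    field
      f : Fin H.size → Fin H′.size
      g : Fin H′.size → Fin H.size
      gf : ∀ x → g (f x) ≡ x
      fg : ∀ y → f (g y) ≡ y
      mono : ∀ x y → H._≼_ x y → H′._≼_ (f x) (f y)
      refl-mono : ∀ x y → H′._≼_ (f x) (f y) → H._≼_ x y
      label : ∀ x → H′.ε (f x) ≡ H.ε x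

  FCFinite : Set₁
  FCFinite = Σ (List Heap) λ L → ∀ H → Any (λ H′ → H ≅ H′) L

  data Reach (s : Fin n) : Fin n → Fin n → Set where
    here : ∀ {v} → v ≢ s → Reach s v v
    step : ∀ {v u w} → Reach s v u → Adj u w → w ≢ s → Reach s v w

  -- vertex set of Γ_{s→t}: {s} ∪ (component of t in Γ ∖ s)
  Γ→ : Fin n → Fin n → Fin n → Set
  Γ→ s t u = u ≡ s ⊎ Reach s t u

  TypeA : (Fin n → Set) → Set
  TypeA P = Σ ℕ λ k → 2 ≤ k × Σ (Fin k → Fin n) λ f →
              (∀ i j → f i ≡ f j → i ≡ j) ×
              (∀ i → P (f i)) ×
              (∀ u → P u → Σ (Fin k) λ i → f i ≡ u) ×
              (∀ i j → toℕ j ≡ suc (toℕ i) → m M (f i) (f j) ≡ fin 3) ×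
              (∀ i j → suc (suc (toℕ i)) ≤ toℕ j → m M (f i) (f j) ≡ fin 2)

module Submission where

-- Suppose t₁ ≠ t₂ and neither Γ_{s→t₁} nor Γ_{s→t₂} is of type A.  Walk from s into a
-- branch along edges labelled 3 whose inner vertices have degree two.  The walk cannot
-- just stop (the branch would be of type A), so it closes a cycle, meets an edge with
-- label m ≥ 4, or meets a vertex with two further neighbours that commute.  A cycle can be
-- run around forever.  Otherwise the obstructions of the two branches are joined through s
-- into a path along which one shuttles back and forth, turning at each end either by a
-- braid aba with m(a,b) ≥ 4 or by a detour through the commuting neighbour.  All prefixes
-- of these infinite words are fully commutative, with heaps of every size, so Γ is not
-- FC-finite.

open import Defs hiding (sym; off)
open import Data.Bool using (Bool; true; false; T; not)
open import Data.Empty using (⊥; ⊥-elim)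
open import Data.Fin using (Fin; toℕ; fromℕ<)
import Data.Fin as Fin
open import Data.Fin.Properties using (toℕ-injective; toℕ-fromℕ<; fromℕ<-toℕ; toℕ<n; injective⇒≤; any?) renaming (_≟_ to _≟ᶠ_)
open import Data.List using (List; []; _∷_)
open import Data.List.Relation.Unary.Any using (Any; here; there)
open import Data.Nat using (ℕ; zero; suc; _≤_; _<_; _+_; _∸_; _⊔_; s≤s; z≤n; _≤?_)
open import Data.Nat.Properties
open import Data.Product using (Σ; ∃; _×_; _,_; proj₁; proj₂)
open import Data.Sum using (_⊎_; inj₁; inj₂; [_,_]′) renaming (map to map⊎)
open import Data.Unit using (tt)
open import Function using (_∘_)
open import Relation.Binary using (DecidableEquality; tri<; tri≈; tri>)
open import Relation.Binary.Construct.Closure.Transitive using (TransClosure; [_]; _∷_; _∷ʳ_)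
open import Relation.Binary.PropositionalEquality
open import Relation.Nullary using (¬_; Dec; yes; no)
open import Relation.Nullary.Decidable using (T?; ¬?; _×-dec_; decidable-stable; toSum)

_≟ᴸ_ : DecidableEquality Label
fin k ≟ᴸ fin l with k ≟ l
... | yes refl = yes refl
... | no k≢l = no λ { refl → k≢l refl }
fin _ ≟ᴸ ∞ = no λ ()
∞ ≟ᴸ fin _ = no λ ()
∞ ≟ᴸ ∞ = yes refl

<⇒offset : ∀ {a b} → a < b → ∃ λ d → suc d + a ≡ b
<⇒offset {a} {b} a<b = b ∸ suc a , trans (sym (+-suc (b ∸ suc a) a)) (m∸n+n≡m a<b)

≤-suc-cases : ∀ {i K} → i ≤ suc K → i ≤ K ⊎ i ≡ suc K
≤-suc-cases i≤1+K with m≤n⇒m<n∨m≡n i≤1+K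
... | inj₁ i<1+K = inj₁ (≤-pred i<1+K)
... | inj₂ i≡1+K = inj₂ i≡1+K

module _ {n : ℕ} (M : CoxeterMatrix n) where

  𝒞-refl : ∀ a → 𝒞 M a a
  𝒞-refl a e with trans (sym (diag M a)) e
  ... | ()

  𝒞-sym : ∀ {a b} → 𝒞 M a b → 𝒞 M b a
  𝒞-sym {a} {b} c e = c (trans (CoxeterMatrix.sym M a b) e)

  𝒞? : ∀ a b → Dec (𝒞 M a b)
  𝒞? a b = ¬? (m M a b ≟ᴸ fin 2)

  𝒞-stable : ∀ {a b} → ¬ ¬ 𝒞 M a b → 𝒞 M a b
  𝒞-stable = decidable-stable (𝒞? _ _)

  ¬𝒞⇒≢ : ∀ {a b} → ¬ 𝒞 M a b → a ≢ b
  ¬𝒞⇒≢ {a} a≁a refl = a≁a (𝒞-refl a)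

  Adj⇒𝒞 : ∀ {a b} → Adj M a b → 𝒞 M a b
  Adj⇒𝒞 a~b m≡2 = subst (T ∘ isEdge) m≡2 a~b

  Adj⇒≢ : ∀ {a b} → Adj M a b → a ≢ b
  Adj⇒≢ {a} a~a refl = subst (T ∘ isEdge) (diag M a) a~a

  Adj-sym : ∀ {a b} → Adj M a b → Adj M b a
  Adj-sym {a} {b} = subst (T ∘ isEdge) (CoxeterMatrix.sym M a b)

  Adj? : ∀ a b → Dec (Adj M a b)
  Adj? a b = T? (isEdge (m M a b))

  ¬Adj⇒m≡2 : ∀ {a b} → a ≢ b → ¬ Adj M a b → m M a b ≡ fin 2
  ¬Adj⇒m≡2 {a} {b} a≢b a≁b with CoxeterMatrix.off M a b a≢b
  ... | inj₁ m≡∞ = ⊥-elim (a≁b (subst (T ∘ isEdge) (sym m≡∞) tt))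
  ... | inj₂ (k , m≡k , 2≤k) with m≤n⇒m<n∨m≡n 2≤k
  ...   | inj₂ refl = m≡k
  ...   | inj₁ 3≤k = ⊥-elim (a≁b (subst (T ∘ isEdge) (sym m≡k) (≤⇒≤ᵇ 3≤k)))

  𝒞∧≢⇒Adj : ∀ {a b} → 𝒞 M a b → a ≢ b → Adj M a b
  𝒞∧≢⇒Adj c a≢b = decidable-stable (Adj? _ _) λ a≁b → c (¬Adj⇒m≡2 a≢b a≁b)

  ≅⇒size≤ : ∀ {H H′ : Heap M} → _≅_ M H H′ → Heap.size H ≤ Heap.size H′
  ≅⇒size≤ H≅H′ = injective⇒≤ λ {x} {y} fx≡fy → trans (sym (gf x)) (trans (cong g fx≡fy) (gf y))
    where open _≅_ H≅H′

  maxSize : List (Heap M) → ℕ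
  maxSize [] = 0
  maxSize (H ∷ Hs) = Heap.size H ⊔ maxSize Hs

  size≤maxSize : ∀ {H} Hs → Any (_≅_ M H) Hs → Heap.size H ≤ maxSize Hs
  size≤maxSize (H′ ∷ Hs) (here H≅H′) = ≤-trans (≅⇒size≤ H≅H′) (m≤m⊔n _ _)
  size≤maxSize (H′ ∷ Hs) (there H∈Hs) = ≤-trans (size≤maxSize Hs H∈Hs) (m≤n⊔m _ _)

  unboundedHeaps⇒¬FCFinite : (∀ N → Σ (Heap M) λ H → N ≤ Heap.size H) → ¬ FCFinite M
  unboundedHeaps⇒¬FCFinite big (Hs , complete) with big (suc (maxSize Hs))
  ... | H , bound≤size = 1+n≰n (≤-trans bound≤size (size≤maxSize Hs (complete H)))

  -- A walk in the generating set whose labels, read as a word, have prefixes that are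
  -- all fully commutative: the conditions below make the heap of every prefix the
  -- order on positions in which i and i + 1 are incomparable exactly when their labels
  -- commute, and all other pairs are ordered as in ℕ.
  record AdmissibleWalk : Set₁ where
    field
      State       : Set
      next        : State → State
      label       : State → Fin n
      Valid       : State → Set
      start       : State
      start-valid : Valid start
      next-valid  : ∀ σ → Valid σ → Valid (next σ)

    next² : State → State
    next² σ = next (next σ)

    next³ : State → State
    next³ σ = next (next² σ)

    Commuting : State → Set
    Commuting σ = ¬ 𝒞 M (label σ) (label (next σ))

    field
      succ-distinct       : ∀ σ → Valid σ → label σ ≢ label (next σ)
      commuting-apart₁    : ∀ σ → Valid σ → Commuting σ → ¬ Commuting (next σ)
      commuting-apart₂    : ∀ σ → Valid σ → Commuting σ → ¬ Commuting (next² σ)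
      commuting-apart₃    : ∀ σ → Valid σ → Commuting σ → ¬ Commuting (next³ σ)
      commuting⇒𝒞-over    : ∀ σ → Valid σ → Commuting σ → 𝒞 M (label σ) (label (next² σ))
      commuting⇒𝒞-under   : ∀ σ → Valid σ → Commuting (next σ) → 𝒞 M (label σ) (label (next² σ))
      commuting⇒≢₃        : ∀ σ → Valid σ → Commuting σ → label σ ≢ label (next³ σ)
      commuting⇒≢₃′       : ∀ σ → Valid σ → Commuting (next² σ) → label σ ≢ label (next³ σ)
      repeat⇒𝒞            : ∀ σ → Valid σ → label σ ≡ label (next² σ) → 𝒞 M (label σ) (label (next σ))
      repeat⇒label≢3      : ∀ σ → Valid σ → label σ ≡ label (next² σ) →
                            m M (label σ) (label (next σ)) ≢ fin 3
      repeat⇒no-repeat    : ∀ σ → Valid σ → label σ ≡ label (next² σ) → label (next σ) ≢ label (next³ σ)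

  module WordOrder (w : ℕ → Fin n) where

    _⊑_ : ℕ → ℕ → Set
    a ⊑ b = a ≤ b × (b ≡ suc a → 𝒞 M (w a) (w b))

    ⊑-refl : ∀ a → a ⊑ a
    ⊑-refl a = ≤-refl , λ a≡1+a → ⊥-elim (m≢1+n+m a {0} a≡1+a)

    ⊑-trans : ∀ {a b c} → a ⊑ b → b ⊑ c → a ⊑ c
    ⊑-trans {a} {b} {c} (a≤b , a⋖b) (b≤c , b⋖c) = ≤-trans a≤b b≤c , a⋖c
      where
      a⋖c : c ≡ suc a → 𝒞 M (w a) (w c)
      a⋖c refl with m≤n⇒m<n∨m≡n b≤c
      ... | inj₂ refl = a⋖b refl
      ... | inj₁ (s≤s b≤a) with ≤-antisym b≤a a≤b
      ...   | refl = b⋖c refl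

    ⊑-suc : ∀ {a} → 𝒞 M (w a) (w (suc a)) → a ⊑ suc a
    ⊑-suc {a} c = n≤1+n a , λ _ → c

    ⊑-far : ∀ {a b} → 2 + a ≤ b → a ⊑ b
    ⊑-far {a} 2+a≤b = <⇒≤ (≤-trans (n≤1+n (suc a)) 2+a≤b) , λ { refl → ⊥-elim (1+n≰n 2+a≤b) }

    Between : ℕ → ℕ → ℕ → Set
    Between a c b = a < c × c < b × a ⊑ c × c ⊑ b

    Interval₃ : ℕ → ℕ → ℕ → Set
    Interval₃ a mid b = ∀ c → a ⊑ c → c ⊑ b → c ≡ a ⊎ c ≡ mid ⊎ c ≡ b

    between⇒middle : ∀ {a mid b c} → Interval₃ a mid b → Between a c b → c ≡ mid
    between⇒middle {c = c} interval (a<c , c<b , a⊑c , c⊑b) with interval c a⊑c c⊑b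
    ... | inj₁ c≡a = ⊥-elim (<⇒≢ a<c (sym c≡a))
    ... | inj₂ (inj₁ c≡mid) = c≡mid
    ... | inj₂ (inj₂ c≡b) = ⊥-elim (<⇒≢ c<b c≡b)

  module PrefixHeaps (W : AdmissibleWalk) where
    open AdmissibleWalk W

    walk : ℕ → State
    walk zero = start
    walk (suc i) = next (walk i)

    valid : ∀ i → Valid (walk i)
    valid zero = start-valid
    valid (suc i) = next-valid _ (valid i)

    w : ℕ → Fin n
    w i = label (walk i)

    open WordOrder w

    ⊑-below-commuting : ∀ a d → Commuting (walk (2 + d + a)) → a ⊑ (suc d + a)
    ⊑-below-commuting a zero comm =
      ⊑-suc (𝒞-stable λ comm₀ → commuting-apart₂ (walk a) (valid a) comm₀ comm)
    ⊑-below-commuting a (suc d) _ = ⊑-far (s≤s (s≤s (m≤n+m a d)))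

    2+a-between : ∀ a d → Between a (2 + a) (4 + d + a)
    2+a-between a d = n≤1+n (suc a) , s≤s (s≤s (s≤s (m≤n+m a (suc d)))) , ⊑-far ≤-refl
                    , ⊑-far (s≤s (s≤s (s≤s (s≤s (m≤n+m a d)))))

    two-between⇒⊥ : ∀ {a mid b c c′} → Interval₃ a mid b → c < c′ → Between a c b → Between a c′ b → ⊥
    two-between⇒⊥ interval c<c′ c-between c′-between =
      <⇒≢ c<c′ (trans (between⇒middle interval c-between) (sym (between⇒middle interval c′-between)))

    repeat⇒between : ∀ {a b} → a < b → w a ≡ w b → ∃ λ c → Between a c b
    repeat⇒between {a} a<b w≡ with <⇒offset a<b
    ... | zero , refl = ⊥-elim (succ-distinct (walk a) (valid a) w≡)
    ... | suc zero , refl = suc a , ≤-refl , ≤-refl , ⊑-suc c₀ , ⊑-suc (subst (𝒞 M (w (suc a))) w≡ (𝒞-sym c₀))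
      where
      c₀ : 𝒞 M (w a) (w (suc a))
      c₀ = repeat⇒𝒞 (walk a) (valid a) w≡
    ... | suc (suc d) , refl with 𝒞? (w a) (w (suc a))
    ...   | yes c₀ = suc a , ≤-refl , s≤s (s≤s (m≤n+m a (suc d)))
                     , ⊑-suc c₀ , ⊑-far (s≤s (s≤s (s≤s (m≤n+m a d))))
    ...   | no comm = 2 + a , n≤1+n (suc a) , s≤s (s≤s (s≤s (m≤n+m a d))) , ⊑-far ≤-refl , 2+a⊑ d
      where
      2+a⊑ : ∀ e → (2 + a) ⊑ (3 + e + a)
      2+a⊑ zero = ⊑-suc (𝒞-stable (commuting-apart₂ (walk a) (valid a) comm))
      2+a⊑ (suc e) = ⊑-far (s≤s (s≤s (s≤s (s≤s (m≤n+m a e)))))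

    repeat-around⇒consecutive : ∀ {a mid b} → a < mid → mid < b → w a ≡ w b → Interval₃ a mid b → b ≡ 2 + a
    repeat-around⇒consecutive {a} a<mid mid<b w≡ interval with <⇒offset (<-trans a<mid mid<b)
    ... | zero , refl = ⊥-elim (<⇒≱ a<mid (≤-pred mid<b))
    ... | suc zero , refl = refl
    ... | suc (suc zero) , refl with 𝒞? (w a) (w (suc a)) | 𝒞? (w (2 + a)) (w (3 + a))
    ...   | no comm | _ = ⊥-elim (commuting⇒≢₃ (walk a) (valid a) comm w≡)
    ...   | yes _ | no comm = ⊥-elim (commuting⇒≢₃′ (walk a) (valid a) comm w≡)
    ...   | yes c₀ | yes c₂ = ⊥-elim (two-between⇒⊥ interval ≤-refl
            (≤-refl , n≤1+n (2 + a) , ⊑-suc c₀ , ⊑-far ≤-refl)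
            (n≤1+n (suc a) , ≤-refl , ⊑-far ≤-refl , ⊑-suc c₂))
    repeat-around⇒consecutive {a} a<mid mid<b w≡ interval | suc (suc (suc d)) , refl
      with 𝒞? (w (3 + a)) (w (4 + a))
    ... | yes c₃ = ⊥-elim (two-between⇒⊥ interval ≤-refl (2+a-between a d)
            (m≤n+m (suc a) 2 , s≤s (s≤s (s≤s (s≤s (m≤n+m a d)))) , ⊑-far (n≤1+n (2 + a)) , 3+a⊑ d))
      where
      3+a⊑ : ∀ e → (3 + a) ⊑ (4 + e + a)
      3+a⊑ zero = ⊑-suc c₃
      3+a⊑ (suc e) = ⊑-far (s≤s (s≤s (s≤s (s≤s (s≤s (m≤n+m a e))))))
    ... | no comm = ⊥-elim (two-between⇒⊥ interval ≤-refl
            (≤-refl , s≤s (s≤s (m≤n+m a (2 + d))) , ⊑-suc c₀ , ⊑-far (s≤s (s≤s (s≤s (m≤n+m a (suc d))))))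
            (2+a-between a d))
      where
      c₀ : 𝒞 M (w a) (w (suc a))
      c₀ = 𝒞-stable λ comm₀ → commuting-apart₃ (walk a) (valid a) comm₀ comm

    module Prefix (N : ℕ) where

      _≼_ : Fin N → Fin N → Set
      x ≼ y = toℕ x ⊑ toℕ y

      ε : Fin N → Fin n
      ε x = w (toℕ x)

      R : Fin N → Fin N → Set
      R x y = x ≼ y × 𝒞 M (ε x) (ε y)

      ≺⇒< : ∀ {x y} → x ≼ y × x ≢ y → toℕ x < toℕ y
      ≺⇒< (x≼y , x≢y) = ≤∧≢⇒< (proj₁ x≼y) (x≢y ∘ toℕ-injective)

      R-at : ∀ {a b} .(a<N : a < N) .(b<N : b < N) → a ⊑ b → 𝒞 M (w a) (w b) →
             R (fromℕ< a<N) (fromℕ< b<N)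
      R-at a<N b<N a⊑b c = subst₂ (λ i j → i ⊑ j × 𝒞 M (w i) (w j))
        (sym (toℕ-fromℕ< a<N)) (sym (toℕ-fromℕ< b<N)) (a⊑b , c)

      lower : ∀ {b} → suc b < N → b < N
      lower {b} = ≤-trans (n≤1+n (suc b))

      -- Walk down from b in steps of one or two, never across a commuting pair.  The last
      -- case splits with [_,_]′ rather than a with-clause, which would hide the decrease of d
      -- from the termination checker.
      chain : ∀ {a} .(a<N : a < N) d .(b<N : d + a < N) → a ⊑ (d + a) →
              TransClosure R (fromℕ< a<N) (fromℕ< b<N)
      chain a<N zero b<N a⊑b = [ R-at a<N b<N a⊑b (𝒞-refl _) ]
      chain a<N (suc zero) b<N a⊑b = [ R-at a<N b<N a⊑b (proj₂ a⊑b refl) ]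
      chain {a} a<N (suc (suc zero)) b<N a⊑b with 𝒞? (w a) (w (suc a)) | 𝒞? (w (suc a)) (w (2 + a))
      ... | no comm | _ = [ R-at a<N b<N a⊑b (commuting⇒𝒞-over (walk a) (valid a) comm) ]
      ... | yes _ | no comm = [ R-at a<N b<N a⊑b (commuting⇒𝒞-under (walk a) (valid a) comm) ]
      ... | yes c₀ | yes c₁ = R-at a<N (lower b<N) (⊑-suc c₀) c₀ ∷ [ R-at (lower b<N) b<N (⊑-suc c₁) c₁ ]
      chain {a} a<N (suc (suc (suc d))) b<N _ =
        [ (λ c → chain a<N (suc (suc d)) (lower b<N) (⊑-far (s≤s (s≤s (m≤n+m a d))))
                   ∷ʳ R-at (lower b<N) b<N (⊑-suc c) c)
        , (λ comm → chain a<N (suc d) (lower (lower b<N)) (⊑-below-commuting a d comm)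
                      ∷ʳ R-at (lower (lower b<N)) b<N (⊑-far ≤-refl)
                           (commuting⇒𝒞-under (walk (suc d + a)) (valid (suc d + a)) comm))
        ]′ (toSum (𝒞? (w (2 + d + a)) (w (3 + d + a))))

      closure⇒ : ∀ x y → x ≼ y → TransClosure R x y
      closure⇒ x y x≼y =
        subst₂ (TransClosure R) (fromℕ<-toℕ x (toℕ<n x)) (toℕ-injective (trans (toℕ-fromℕ< y<N) y≡))
          (chain (toℕ<n x) (toℕ y ∸ toℕ x) y<N (subst (toℕ x ⊑_) (sym y≡) x≼y))
        where
        y≡ : (toℕ y ∸ toℕ x) + toℕ x ≡ toℕ y
        y≡ = m∸n+n≡m (proj₁ x≼y)
        y<N : (toℕ y ∸ toℕ x) + toℕ x < N
        y<N = subst (_< N) (sym y≡) (toℕ<n y)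

      closure⇐ : ∀ x y → TransClosure R x y → x ≼ y
      closure⇐ x y [ x≼y , _ ] = x≼y
      closure⇐ x y ((x≼z , _) ∷ z≼⁺y) = ⊑-trans x≼z (closure⇐ _ y z≼⁺y)

      comparable : ∀ x y → 𝒞 M (ε x) (ε y) → x ≼ y ⊎ y ≼ x
      comparable x y c with ≤-total (toℕ x) (toℕ y)
      ... | inj₁ x≤y = inj₁ (x≤y , λ _ → c)
      ... | inj₂ y≤x = inj₂ (y≤x , λ _ → 𝒞-sym c)

      between⇒¬cover : ∀ {x y} z → Between (toℕ x) (toℕ z) (toℕ y) →
                       ¬ (∀ z → x ≼ z → z ≼ y → z ≡ x ⊎ z ≡ y)
      between⇒¬cover z (x<z , z<y , x⊑z , z⊑y) cover with cover z x⊑z z⊑y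
      ... | inj₁ refl = <-irrefl refl x<z
      ... | inj₂ refl = <-irrefl refl z<y

      noCover : ∀ x y → x ≼ y × x ≢ y → (∀ z → x ≼ z → z ≼ y → z ≡ x ⊎ z ≡ y) → ε x ≢ ε y
      noCover x y x≺y cover εx≡εy with repeat⇒between (≺⇒< x≺y) εx≡εy
      ... | c , c-between@(_ , c<y , _) =
        between⇒¬cover (fromℕ< (<-trans c<y (toℕ<n y)))
          (subst (λ i → Between (toℕ x) i (toℕ y)) (sym (toℕ-fromℕ< (<-trans c<y (toℕ<n y)))) c-between)
          cover

      module AlternatingChain (s t : Fin n) {k} (α : Fin (3 + k) → Fin N)
          (increasing : ∀ i j → toℕ j ≡ suc (toℕ i) → α i ≼ α j × α i ≢ α j)
          (labels : ∀ i → ε (α i) ≡ alt M s t i)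
          (convex : ∀ x → (Σ (Fin (3 + k)) λ i → α i ≼ x) → (Σ (Fin (3 + k)) λ j → x ≼ α j) →
                    Σ (Fin (3 + k)) λ l → α l ≡ x) where

        pos : Fin (3 + k) → ℕ
        pos i = toℕ (α i)

        pos-increasing′ : ∀ d {i j} → toℕ j ≡ suc (d + toℕ i) → pos i < pos j
        pos-increasing′ zero j≡ = ≺⇒< (increasing _ _ j≡)
        pos-increasing′ (suc d) {i} {j} j≡ =
          <-trans (pos-increasing′ d (toℕ-fromℕ< j′<))
                  (≺⇒< (increasing j′ j (trans j≡ (cong suc (sym (toℕ-fromℕ< j′<))))))
          where
          j′< : suc (d + toℕ i) < 3 + k
          j′< = <-trans (n<1+n _) (subst (_< 3 + k) j≡ (toℕ<n j))
          j′ : Fin (3 + k)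
          j′ = fromℕ< j′<

        pos-increasing : ∀ {i j} → toℕ i < toℕ j → pos i < pos j
        pos-increasing i<j with <⇒offset i<j
        ... | d , j≡ = pos-increasing′ d (sym j≡)

        index-between : ∀ {j₀ j₁ j₂ l} → toℕ j₁ ≡ suc (toℕ j₀) → toℕ j₂ ≡ suc (toℕ j₁) →
                        pos j₀ ≤ pos l → pos l ≤ pos j₂ → l ≡ j₀ ⊎ l ≡ j₁ ⊎ l ≡ j₂
        index-between {j₀} {j₁} {j₂} {l} j₁≡ j₂≡ p₀≤pₗ pₗ≤p₂ with <-cmp (toℕ l) (toℕ j₀)
        ... | tri< l<j₀ _ _ = ⊥-elim (<⇒≱ (pos-increasing l<j₀) p₀≤pₗ)
        ... | tri≈ _ l≡j₀ _ = inj₁ (toℕ-injective l≡j₀)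
        ... | tri> _ _ j₀<l with m≤n⇒m<n∨m≡n (subst (_≤ toℕ l) (sym j₁≡) j₀<l)
        ...   | inj₂ j₁≡l = inj₂ (inj₁ (toℕ-injective (sym j₁≡l)))
        ...   | inj₁ j₁<l with m≤n⇒m<n∨m≡n (subst (_≤ toℕ l) (sym j₂≡) j₁<l)
        ...     | inj₂ j₂≡l = inj₂ (inj₂ (toℕ-injective (sym j₂≡l)))
        ...     | inj₁ j₂<l = ⊥-elim (<⇒≱ (pos-increasing j₂<l) pₗ≤p₂)

        convex-index : ∀ {j₀ j₂} c → pos j₀ ⊑ c → c ⊑ pos j₂ → Σ (Fin (3 + k)) λ l → pos l ≡ c
        convex-index {j₀} {j₂} c p₀⊑c c⊑p₂ =
          found (convex z (j₀ , subst (pos j₀ ⊑_) (sym toℕz≡c) p₀⊑c)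
                          (j₂ , subst (_⊑ pos j₂) (sym toℕz≡c) c⊑p₂))
          where
          c<N : c < N
          c<N = ≤-<-trans (proj₁ c⊑p₂) (toℕ<n (α j₂))
          z : Fin N
          z = fromℕ< c<N
          toℕz≡c : toℕ z ≡ c
          toℕz≡c = toℕ-fromℕ< c<N
          found : (Σ (Fin (3 + k)) λ l → α l ≡ z) → Σ (Fin (3 + k)) λ l → pos l ≡ c
          found (l , αl≡z) = l , trans (cong toℕ αl≡z) toℕz≡c

        interval : ∀ {j₀ j₁ j₂} → toℕ j₁ ≡ suc (toℕ j₀) → toℕ j₂ ≡ suc (toℕ j₁) →
                   Interval₃ (pos j₀) (pos j₁) (pos j₂)
        interval j₁≡ j₂≡ c p₀⊑c c⊑p₂ with convex-index c p₀⊑c c⊑p₂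
        ... | l , refl = map⊎ (cong pos) (map⊎ (cong pos) (cong pos))
                           (index-between j₁≡ j₂≡ (proj₁ p₀⊑c) (proj₁ c⊑p₂))

        consecutive : ∀ {j₀ j₁ j₂} → toℕ j₁ ≡ suc (toℕ j₀) → toℕ j₂ ≡ suc (toℕ j₁) →
                      w (pos j₀) ≡ w (pos j₂) → pos j₁ ≡ suc (pos j₀) × pos j₂ ≡ 2 + pos j₀
        consecutive {j₀} {j₁} {j₂} j₁≡ j₂≡ w≡ = ≤-antisym (≤-pred (subst (pos j₁ <_) p₂≡ p₁<p₂)) p₀<p₁ , p₂≡
          where
          p₀<p₁ : pos j₀ < pos j₁
          p₀<p₁ = pos-increasing (≤-reflexive (sym j₁≡))
          p₁<p₂ : pos j₁ < pos j₂
          p₁<p₂ = pos-increasing (≤-reflexive (sym j₂≡))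
          p₂≡ : pos j₂ ≡ 2 + pos j₀
          p₂≡ = repeat-around⇒consecutive p₀<p₁ p₁<p₂ w≡ (interval j₁≡ j₂≡)

        i₀ i₁ i₂ : Fin (3 + k)
        i₀ = Fin.zero
        i₁ = Fin.suc Fin.zero
        i₂ = Fin.suc (Fin.suc Fin.zero)

        p : ℕ
        p = pos i₀

        first-three : pos i₁ ≡ suc p × pos i₂ ≡ 2 + p
        first-three = consecutive refl refl (trans (labels i₀) (sym (labels i₂)))

        w[p]≡s : w p ≡ s
        w[p]≡s = labels i₀

        w[1+p]≡t : w (suc p) ≡ t
        w[1+p]≡t = trans (cong w (sym (proj₁ first-three))) (labels i₁)

        w[2+p]≡s : w (2 + p) ≡ s
        w[2+p]≡s = trans (cong w (sym (proj₂ first-three))) (labels i₂)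

      -- Convexity forces the chain s, t, s, … onto consecutive positions p, p + 1, p + 2, …,
      -- where the repeat conditions of the walk rule it out.
      noConvexChain : ∀ s t k → m M s t ≡ fin k → 3 ≤ k → (α : Fin k → Fin N) →
        (∀ i j → toℕ j ≡ suc (toℕ i) → α i ≼ α j × α i ≢ α j) →
        (∀ i → ε (α i) ≡ alt M s t i) →
        (∀ x → (Σ (Fin k) λ i → α i ≼ x) → (Σ (Fin k) λ j → x ≼ α j) → Σ (Fin k) λ l → α l ≡ x) → ⊥
      noConvexChain s t 3 m≡3 (s≤s (s≤s (s≤s z≤n))) α increasing labels convex =
        repeat⇒label≢3 (walk p) (valid p) (trans w[p]≡s (sym w[2+p]≡s))
          (subst₂ (λ u v → m M u v ≡ fin 3) (sym w[p]≡s) (sym w[1+p]≡t) m≡3)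
        where open AlternatingChain s t α increasing labels convex
      noConvexChain s t (suc (suc (suc (suc k)))) _ (s≤s (s≤s (s≤s z≤n))) α increasing labels convex =
        repeat⇒no-repeat (walk p) (valid p) (trans w[p]≡s (sym w[2+p]≡s)) (trans w[1+p]≡t (sym w[3+p]≡t))
        where
        open AlternatingChain s t α increasing labels convex
        i₃ : Fin (4 + k)
        i₃ = Fin.suc (Fin.suc (Fin.suc Fin.zero))
        pos₃ : pos i₃ ≡ 3 + p
        pos₃ = trans (proj₂ (consecutive {i₁} {i₂} {i₃} refl refl (trans (labels i₁) (sym (labels i₃)))))
                     (cong (2 +_) (proj₁ first-three))
        w[3+p]≡t : w (3 + p) ≡ t
        w[3+p]≡t = trans (cong w (sym pos₃)) (labels i₃)

      heap : Heap M
      heap = record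
        { size = N
        ; _≼_ = _≼_
        ; ε = ε
        ; isPO = record
          { isPreorder = record
            { isEquivalence = isEquivalence
            ; reflexive = λ { refl → ⊑-refl _ }
            ; trans = ⊑-trans
            }
          ; antisym = λ x≼y y≼x → toℕ-injective (≤-antisym (proj₁ x≼y) (proj₁ y≼x))
          }
        ; comparable = comparable
        ; closure⇒ = closure⇒
        ; closure⇐ = closure⇐
        ; noConvexChain = noConvexChain
        ; noCover = noCover
        }

  admissibleWalk⇒¬FCFinite : AdmissibleWalk → ¬ FCFinite M
  admissibleWalk⇒¬FCFinite W = unboundedHeaps⇒¬FCFinite λ N → heap N , ≤-refl
    where open PrefixHeaps W using (module Prefix)
          open Prefix using (heap)

  record Cycle : Set where
    field
      len       : ℕ
      vertex    : ℕ → Fin n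
      edge      : ∀ d → suc d ≤ 2 + len → Adj M (vertex (suc d)) (vertex d)
      closing   : Adj M (vertex 0) (vertex (2 + len))
      injective : ∀ i j → i ≤ 2 + len → j ≤ 2 + len → vertex i ≡ vertex j → i ≡ j

  module CycleWalk (C : Cycle) where
    open Cycle C

    next : ℕ → ℕ
    next (suc d) = d
    next zero = 2 + len

    Valid : ℕ → Set
    Valid d = d ≤ 2 + len

    next-valid : ∀ d → Valid d → Valid (next d)
    next-valid (suc d) d<top = ≤-trans (n≤1+n d) d<top
    next-valid zero _ = ≤-refl

    edge-next : ∀ d → Valid d → Adj M (vertex d) (vertex (next d))
    edge-next (suc d) d<top = edge d d<top
    edge-next zero _ = closing

    never-commuting : ∀ d → Valid d → ¬ ¬ 𝒞 M (vertex d) (vertex (next d))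
    never-commuting d valid comm = comm (Adj⇒𝒞 (edge-next d valid))

    never-repeating : ∀ d → Valid d → vertex d ≢ vertex (next (next d))
    never-repeating d valid repeat =
      d≢next² d (injective d (next (next d)) valid (next-valid _ (next-valid d valid)) repeat)
      where
      d≢next² : ∀ d → d ≢ next (next d)
      d≢next² (suc (suc d)) 2+d≡d = m≢1+n+m d {1} (sym 2+d≡d)
      d≢next² (suc zero) ()
      d≢next² zero ()

    walk : AdmissibleWalk
    walk = record
      { State = ℕ
      ; next = next
      ; label = vertex
      ; Valid = Valid
      ; start = 0
      ; start-valid = z≤n
      ; next-valid = next-valid
      ; succ-distinct = λ d valid → Adj⇒≢ (edge-next d valid)
      ; commuting-apart₁ = λ d valid comm → ⊥-elim (never-commuting d valid comm)
      ; commuting-apart₂ = λ d valid comm → ⊥-elim (never-commuting d valid comm)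
      ; commuting-apart₃ = λ d valid comm → ⊥-elim (never-commuting d valid comm)
      ; commuting⇒𝒞-over = λ d valid comm → ⊥-elim (never-commuting d valid comm)
      ; commuting⇒𝒞-under = λ d valid comm → ⊥-elim (never-commuting _ (next-valid d valid) comm)
      ; commuting⇒≢₃ = λ d valid comm → ⊥-elim (never-commuting d valid comm)
      ; commuting⇒≢₃′ = λ d valid comm → ⊥-elim (never-commuting _ (next-valid _ (next-valid d valid)) comm)
      ; repeat⇒𝒞 = λ d valid repeat → ⊥-elim (never-repeating d valid repeat)
      ; repeat⇒label≢3 = λ d valid repeat → ⊥-elim (never-repeating d valid repeat)
      ; repeat⇒no-repeat = λ d valid repeat → ⊥-elim (never-repeating d valid repeat)
      }

  cycle⇒¬FCFinite : Cycle → ¬ FCFinite M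
  cycle⇒¬FCFinite C = admissibleWalk⇒¬FCFinite (CycleWalk.walk C)

  Detour : (ℕ → Fin n) → ℕ → Fin n → Set
  Detour track span x = Adj M (track 1) x × ¬ 𝒞 M (track 0) x × x ≢ track 2 × 1 ≤ span

  data Turn (track : ℕ → Fin n) (span : ℕ) : Set where
    reflect : m M (track 1) (track 0) ≢ fin 3 → Turn track span
    detour  : ∀ x → Detour track span x → Turn track span

  -- A path track false 0, …, track false (2 + span), also read backwards as track true.
  -- A shuttle runs down a track to its end 0 and turns onto the other track, either
  -- directly or through a detour vertex.
  record Shuttle : Set where
    field
      span            : ℕ
      track           : Bool → ℕ → Fin n
      track-edge      : ∀ b d → suc d ≤ 2 + span → Adj M (track b (suc d)) (track b d)
      track-distinct₂ : ∀ b d → 2 + d ≤ 2 + span → track b d ≢ track b (2 + d)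
      track-reverse   : ∀ b d e → d + e ≡ 2 + span → track (not b) d ≡ track b e
      turn            : ∀ b → Turn (track b) span

  module ShuttleWalk (S : Shuttle) where
    open Shuttle S

    data Stop : Set where
      on  : Bool → ℕ → Stop
      off : Bool → Fin n → Stop

    position : Stop → ℕ
    position (on _ d) = d
    position (off _ _) = 0

    bounce : ∀ b → Turn (track b) span → Stop
    bounce b (reflect _) = on (not b) (suc span)
    bounce b (detour x _) = off b x

    next : Stop → Stop
    next (on b (suc d)) = on b d
    next (on b zero) = bounce b (turn b)
    next (off b x) = on (not b) (suc span)

    label : Stop → Fin n
    label (on b d) = track b d
    label (off b x) = x

    Valid : Stop → Set
    Valid (on b d) = d ≤ suc span
    Valid (off b x) = Detour (track b) span x

    next-valid : ∀ σ → Valid σ → Valid (next σ)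
    next-valid (on b (suc d)) d≤ = ≤-trans (n≤1+n d) d≤
    next-valid (on b zero) _ with turn b
    ... | reflect _ = ≤-refl
    ... | detour x valid = valid
    next-valid (off b x) _ = ≤-refl

    Commuting : Stop → Set
    Commuting σ = ¬ 𝒞 M (label σ) (label (next σ))

    reverse₁ : ∀ b → track (not b) (suc span) ≡ track b 1
    reverse₁ b = track-reverse b (suc span) 1 (+-comm (suc span) 1)

    reverse₂ : ∀ b → track (not b) span ≡ track b 2
    reverse₂ b = track-reverse b span 2 (+-comm span 2)

    end-edge : ∀ b → Adj M (track b 1) (track b 0)
    end-edge b = track-edge b 0 (s≤s z≤n)

    end-𝒞-return : ∀ b → 𝒞 M (track b 0) (track (not b) (suc span))
    end-𝒞-return b = subst (𝒞 M (track b 0)) (sym (reverse₁ b)) (𝒞-sym (Adj⇒𝒞 (end-edge b)))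

    commuting⇒detour : ∀ σ → Valid σ → Commuting σ →
      Σ Bool λ b → Σ (Fin n) λ x → σ ≡ on b 0 × next σ ≡ off b x × Detour (track b) span x
    commuting⇒detour (on b (suc d)) d≤ comm = ⊥-elim (comm (Adj⇒𝒞 (track-edge b d (≤-trans d≤ (n≤1+n _)))))
    commuting⇒detour (on b zero) _ comm with turn b
    ... | reflect _ = ⊥-elim (comm (end-𝒞-return b))
    ... | detour x valid = b , x , refl , refl , valid
    commuting⇒detour (off b x) (x-adj , _) comm =
      ⊥-elim (comm (subst (𝒞 M x) (sym (reverse₁ b)) (𝒞-sym (Adj⇒𝒞 x-adj))))

    repeat⇒reflect : ∀ σ → Valid σ → label σ ≡ label (next (next σ)) →
      Σ Bool λ b → σ ≡ on b 1 × next (next σ) ≡ on (not b) (suc span) × m M (track b 1) (track b 0) ≢ fin 3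
    repeat⇒reflect (on b (suc (suc d))) d≤ repeat = ⊥-elim (track-distinct₂ b d (≤-trans d≤ (n≤1+n _)) (sym repeat))
    repeat⇒reflect (on b (suc zero)) _ repeat with turn b
    ... | reflect m≢3 = b , refl , refl , m≢3
    ... | detour x (x-adj , _) = ⊥-elim (Adj⇒≢ x-adj repeat)
    repeat⇒reflect (on b zero) _ repeat with turn b
    ... | reflect _ = ⊥-elim (track-distinct₂ b 0 (s≤s (s≤s z≤n)) (trans repeat (reverse₂ b)))
    ... | detour x _ = ⊥-elim (Adj⇒≢ (end-edge b) (sym (trans repeat (reverse₁ b))))
    repeat⇒reflect (off b x) (_ , _ , x≢ , _) repeat = ⊥-elim (x≢ (trans repeat (reverse₂ b)))

    next≡end⇒ : ∀ {σ b} → next σ ≡ on b 0 → σ ≡ on b 1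
    next≡end⇒ {on c (suc zero)} refl = refl
    next≡end⇒ {on c zero} next≡ with turn c
    next≡end⇒ {on c zero} () | reflect _
    next≡end⇒ {on c zero} () | detour _ _

    next²≡end⇒ : ∀ {σ b} → next (next σ) ≡ on b 0 → 1 ≤ span → σ ≡ on b 2
    next²≡end⇒ {on c (suc (suc zero))} refl _ = refl
    next²≡end⇒ {on c (suc zero)} next²≡ _ with turn c
    next²≡end⇒ {on c (suc zero)} () _ | reflect _
    next²≡end⇒ {on c (suc zero)} () _ | detour _ _
    next²≡end⇒ {on c zero} next²≡ 1≤span with turn c
    ... | reflect _ = ⊥-elim (<⇒≢ 1≤span (sym (cong position next²≡)))
    next²≡end⇒ {on c zero} () _ | detour _ _
    next²≡end⇒ {off c x} next²≡ 1≤span = ⊥-elim (<⇒≢ 1≤span (sym (cong position next²≡)))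

    on≢off : ∀ {b d c x} → on b d ≢ off c x
    on≢off ()

    succ-distinct : ∀ σ → Valid σ → label σ ≢ label (next σ)
    succ-distinct (on b (suc d)) d≤ = Adj⇒≢ (track-edge b d (≤-trans d≤ (n≤1+n _)))
    succ-distinct (on b zero) _ with turn b
    ... | reflect _ = λ 0≡1 → Adj⇒≢ (end-edge b) (sym (trans 0≡1 (reverse₁ b)))
    ... | detour x (_ , x-commutes , _) = ¬𝒞⇒≢ x-commutes
    succ-distinct (off b x) (x-adj , _) x≡ = Adj⇒≢ x-adj (sym (trans x≡ (reverse₁ b)))

    commuting-apart₁ : ∀ σ → Valid σ → Commuting σ → ¬ Commuting (next σ)
    commuting-apart₁ σ valid comm comm′
      with commuting⇒detour σ valid comm | commuting⇒detour (next σ) (next-valid σ valid) comm′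
    ... | _ , _ , _ , next≡off , _ | _ , _ , next≡on , _ = on≢off (trans (sym next≡on) next≡off)

    commuting-apart₂ : ∀ σ → Valid σ → Commuting σ → ¬ Commuting (next (next σ))
    commuting-apart₂ σ valid comm comm″
      with commuting⇒detour σ valid comm
         | commuting⇒detour (next (next σ)) (next-valid _ (next-valid σ valid)) comm″
    ... | _ , _ , _ , next≡off , _ | _ , _ , next²≡on , _ =
      1+n≢0 (cong position (trans (sym (cong next next≡off)) next²≡on))

    commuting-apart₃ : ∀ σ → Valid σ → Commuting σ → ¬ Commuting (next (next (next σ)))
    commuting-apart₃ σ valid comm comm‴
      with commuting⇒detour σ valid comm
         | commuting⇒detour (next (next (next σ))) (next-valid _ (next-valid _ (next-valid σ valid))) comm‴
    ... | _ , _ , _ , next≡off , (_ , _ , _ , 1≤span) | _ , _ , next³≡on , _ =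
      <⇒≢ 1≤span (sym (cong position (trans (sym (cong (next ∘ next) next≡off)) next³≡on)))

    commuting⇒𝒞-over : ∀ σ → Valid σ → Commuting σ → 𝒞 M (label σ) (label (next (next σ)))
    commuting⇒𝒞-over σ valid comm with commuting⇒detour σ valid comm
    ... | b , _ , refl , next≡off , _ =
      subst (λ τ → 𝒞 M (track b 0) (label τ)) (sym (cong next next≡off)) (end-𝒞-return b)

    commuting⇒𝒞-under : ∀ σ → Valid σ → Commuting (next σ) → 𝒞 M (label σ) (label (next (next σ)))
    commuting⇒𝒞-under σ valid comm with commuting⇒detour (next σ) (next-valid σ valid) comm
    ... | b , _ , next≡end , next²≡off , (x-adj , _) with next≡end⇒ {σ} next≡end
    ...   | refl = subst (λ τ → 𝒞 M (track b 1) (label τ)) (sym next²≡off) (Adj⇒𝒞 x-adj)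

    commuting⇒≢₃ : ∀ σ → Valid σ → Commuting σ → label σ ≢ label (next (next (next σ)))
    commuting⇒≢₃ σ valid comm with commuting⇒detour σ valid comm
    ... | b , _ , refl , next≡off , _ = λ 0≡3 →
      track-distinct₂ b 0 (s≤s (s≤s z≤n)) (trans 0≡3 (trans (cong (label ∘ next ∘ next) next≡off) (reverse₂ b)))

    commuting⇒≢₃′ : ∀ σ → Valid σ → Commuting (next (next σ)) → label σ ≢ label (next (next (next σ)))
    commuting⇒≢₃′ σ valid comm with commuting⇒detour (next (next σ)) (next-valid _ (next-valid σ valid)) comm
    ... | b , _ , next²≡end , next³≡off , (_ , _ , x≢ , 1≤span) with next²≡end⇒ {σ} next²≡end 1≤span
    ...   | refl = λ 0≡3 → x≢ (sym (trans 0≡3 (cong label next³≡off)))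

    repeat⇒𝒞 : ∀ σ → Valid σ → label σ ≡ label (next (next σ)) → 𝒞 M (label σ) (label (next σ))
    repeat⇒𝒞 σ valid repeat with repeat⇒reflect σ valid repeat
    ... | b , refl , _ , _ = Adj⇒𝒞 (end-edge b)

    repeat⇒label≢3 : ∀ σ → Valid σ → label σ ≡ label (next (next σ)) →
                     m M (label σ) (label (next σ)) ≢ fin 3
    repeat⇒label≢3 σ valid repeat with repeat⇒reflect σ valid repeat
    ... | b , refl , _ , m≢3 = m≢3

    repeat⇒no-repeat : ∀ σ → Valid σ → label σ ≡ label (next (next σ)) →
                       label (next σ) ≢ label (next (next (next σ)))
    repeat⇒no-repeat σ valid repeat with repeat⇒reflect σ valid repeat
    ... | b , refl , next²≡ , _ = λ 1≡3 →
      track-distinct₂ b 0 (s≤s (s≤s z≤n)) (trans 1≡3 (trans (cong (label ∘ next) next²≡) (reverse₂ b)))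

    walk : AdmissibleWalk
    walk = record
      { State = Stop
      ; next = next
      ; label = label
      ; Valid = Valid
      ; start = on false 0
      ; start-valid = z≤n
      ; next-valid = next-valid
      ; succ-distinct = succ-distinct
      ; commuting-apart₁ = commuting-apart₁
      ; commuting-apart₂ = commuting-apart₂
      ; commuting-apart₃ = commuting-apart₃
      ; commuting⇒𝒞-over = commuting⇒𝒞-over
      ; commuting⇒𝒞-under = commuting⇒𝒞-under
      ; commuting⇒≢₃ = commuting⇒≢₃
      ; commuting⇒≢₃′ = commuting⇒≢₃′
      ; repeat⇒𝒞 = repeat⇒𝒞
      ; repeat⇒label≢3 = repeat⇒label≢3
      ; repeat⇒no-repeat = repeat⇒no-repeat
      }

  shuttle⇒¬FCFinite : Shuttle → ¬ FCFinite M
  shuttle⇒¬FCFinite S = admissibleWalk⇒¬FCFinite (ShuttleWalk.walk S)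

  record Path (s t : Fin n) : Set where
    field
      len       : ℕ
      vertex    : ℕ → Fin n
      starts    : vertex 0 ≡ s
      second    : vertex 1 ≡ t
      edge      : ∀ j → j ≤ len → Adj M (vertex j) (vertex (suc j))
      injective : ∀ i j → i ≤ suc len → j ≤ suc len → vertex i ≡ vertex j → i ≡ j

    last : Fin n
    last = vertex (suc len)

    reversed : ℕ → Fin n
    reversed d = vertex (suc len ∸ d)

  record Arm (s t : Fin n) : Set where
    field
      path : Path s t
      end  : Turn (Path.reversed path) (Path.len path)

  module _ {s t} (P : Path s t) where
    open Path P

    Labels3 : Set
    Labels3 = ∀ j → j ≤ len → m M (vertex j) (vertex (suc j)) ≡ fin 3

    InnerDegree2 : Set
    InnerDegree2 = ∀ l → suc l ≤ len → ∀ u → Adj M (vertex (suc l)) u → u ≡ vertex l ⊎ u ≡ vertex (2 + l)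

    DeadEnd : Set
    DeadEnd = ∀ u → Adj M last u → u ≡ vertex len

  record StraightPath (s t : Fin n) : Set where
    field
      path           : Path s t
      labels3        : Labels3 path
      inner-degree-2 : InnerDegree2 path

  snoc : (ℕ → Fin n) → ℕ → Fin n → ℕ → Fin n
  snoc v K u d with d ≤? K
  ... | yes _ = v d
  ... | no _ = u

  snoc-≤ : ∀ {v K u d} → d ≤ K → snoc v K u d ≡ v d
  snoc-≤ {K = K} {d = d} d≤K with d ≤? K
  ... | yes _ = refl
  ... | no d≰K = ⊥-elim (d≰K d≤K)

  snoc-top : ∀ {v K u} → snoc v K u (suc K) ≡ u
  snoc-top {K = K} with suc K ≤? K
  ... | yes 1+K≤K = ⊥-elim (1+n≰n 1+K≤K)
  ... | no _ = refl

  module Extend {s t} (P : Path s t) (u : Fin n) (last~u : Adj M (Path.last P) u)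
                (fresh : ∀ j → j ≤ suc (Path.len P) → Path.vertex P j ≢ u) where
    open Path P

    vertex′ : ℕ → Fin n
    vertex′ = snoc vertex (suc len) u

    old : ∀ {j} → j ≤ suc len → vertex′ j ≡ vertex j
    old = snoc-≤ {vertex} {suc len} {u}

    new : vertex′ (2 + len) ≡ u
    new = snoc-top {vertex} {suc len} {u}

    edge′ : ∀ j → j ≤ suc len → Adj M (vertex′ j) (vertex′ (suc j))
    edge′ j j≤ with ≤-suc-cases j≤
    ... | inj₁ j≤len = subst₂ (Adj M) (sym (old j≤)) (sym (old (s≤s j≤len))) (edge j j≤len)
    ... | inj₂ refl = subst₂ (Adj M) (sym (old ≤-refl)) (sym new) last~u

    injective′ : ∀ i j → i ≤ 2 + len → j ≤ 2 + len → vertex′ i ≡ vertex′ j → i ≡ j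
    injective′ i j i≤ j≤ v≡ with ≤-suc-cases i≤ | ≤-suc-cases j≤
    ... | inj₁ i≤′ | inj₁ j≤′ = injective i j i≤′ j≤′ (trans (sym (old i≤′)) (trans v≡ (old j≤′)))
    ... | inj₁ i≤′ | inj₂ refl = ⊥-elim (fresh i i≤′ (trans (sym (old i≤′)) (trans v≡ new)))
    ... | inj₂ refl | inj₁ j≤′ = ⊥-elim (fresh j j≤′ (trans (sym (old j≤′)) (trans (sym v≡) new)))
    ... | inj₂ refl | inj₂ refl = refl

    path : Path s t
    path = record
      { len = suc len
      ; vertex = vertex′
      ; starts = trans (old z≤n) starts
      ; second = trans (old (s≤s z≤n)) second
      ; edge = edge′
      ; injective = injective′
      }

  module DeadEndPath {s t} (P : StraightPath s t) (dead-end : DeadEnd (StraightPath.path P)) where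
    open StraightPath P
    open Path path

    neighbours : ∀ l → l ≤ len → ∀ u → Adj M (vertex (suc l)) u →
                 u ≡ vertex l ⊎ (suc l ≤ len × u ≡ vertex (2 + l))
    neighbours l l≤len u v~u with m≤n⇒m<n∨m≡n l≤len
    ... | inj₂ refl = inj₁ (dead-end u v~u)
    ... | inj₁ l<len with inner-degree-2 l l<len u v~u
    ...   | inj₁ u≡ = inj₁ u≡
    ...   | inj₂ u≡ = inj₂ (l<len , u≡)

    beyond-s : ∀ j → j ≤ len → vertex (suc j) ≢ s
    beyond-s j j≤len v≡s with injective (suc j) 0 (s≤s j≤len) z≤n (trans v≡s (sym starts))
    ... | ()

    path⇒reach : ∀ j → j ≤ len → Reach M s t (vertex (suc j))
    path⇒reach zero _ = subst (Reach M s t) (sym second) (here λ t≡s → beyond-s 0 z≤n (trans second t≡s))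
    path⇒reach (suc j) j<len =
      step (path⇒reach j (≤-trans (n≤1+n j) j<len)) (edge (suc j) j<len) (beyond-s (suc j) j<len)

    predecessor : ∀ {w} j → j ≤ len → w ≡ vertex j → w ≢ s → Σ ℕ λ i → i ≤ len × vertex (suc i) ≡ w
    predecessor zero _ w≡ w≢s = ⊥-elim (w≢s (trans w≡ starts))
    predecessor (suc i) i<len w≡ _ = i , ≤-trans (n≤1+n i) i<len , sym w≡

    reach⇒path : ∀ {u} → Reach M s t u → Σ ℕ λ j → j ≤ len × vertex (suc j) ≡ u
    reach⇒path (here _) = 0 , z≤n , second
    reach⇒path (step r u~w w≢s) with reach⇒path r
    ... | j , j≤len , refl with neighbours j j≤len _ u~w
    ...   | inj₁ w≡ = predecessor j j≤len w≡ w≢s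
    ...   | inj₂ (j<len , w≡) = suc j , j<len , sym w≡

    far-apart : ∀ a b → 2 + a ≤ b → b ≤ suc len → ¬ Adj M (vertex a) (vertex b)
    far-apart a (suc (suc b)) (s≤s (s≤s a≤b)) (s≤s b<len) a~b
      with neighbours (suc b) b<len (vertex a) (Adj-sym a~b)
    ... | inj₁ va≡ = <⇒≢ (s≤s a≤b) (injective a (suc b) a≤ (≤-trans (n≤1+n _) (s≤s b<len)) va≡)
      where
      a≤ : a ≤ suc len
      a≤ = ≤-trans a≤b (≤-trans (n≤1+n b) (≤-trans b<len (n≤1+n len)))
    ... | inj₂ (2+b≤len , va≡) =
      <⇒≢ (s≤s (≤-trans a≤b (≤-trans (n≤1+n b) (n≤1+n _)))) (injective a (3 + b) a≤ (s≤s 2+b≤len) va≡)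
      where
      a≤ : a ≤ suc len
      a≤ = ≤-trans a≤b (≤-trans (n≤1+n b) (≤-trans b<len (n≤1+n len)))

    typeA : TypeA M (Γ→ M s t)
    typeA = 2 + len , s≤s (s≤s z≤n) , f , f-injective , f-inside , f-onto , f-consecutive , f-far
      where
      f : Fin (2 + len) → Fin n
      f i = vertex (toℕ i)

      bound : ∀ (i : Fin (2 + len)) → toℕ i ≤ suc len
      bound i = ≤-pred (toℕ<n i)

      f-injective : ∀ i j → f i ≡ f j → i ≡ j
      f-injective i j f≡ = toℕ-injective (injective _ _ (bound i) (bound j) f≡)

      f-inside : ∀ i → Γ→ M s t (f i)
      f-inside Fin.zero = inj₁ starts
      f-inside (Fin.suc i) = inj₂ (path⇒reach (toℕ i) (≤-pred (toℕ<n i)))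

      f-onto : ∀ u → Γ→ M s t u → Σ (Fin (2 + len)) λ i → f i ≡ u
      f-onto u (inj₁ u≡s) = Fin.zero , trans starts (sym u≡s)
      f-onto u (inj₂ reach) with reach⇒path reach
      ... | j , j≤len , v≡u =
        Fin.suc (fromℕ< (s≤s j≤len)) , trans (cong (vertex ∘ suc) (toℕ-fromℕ< (s≤s j≤len))) v≡u

      f-consecutive : ∀ i j → toℕ j ≡ suc (toℕ i) → m M (f i) (f j) ≡ fin 3
      f-consecutive i j j≡ = subst (λ k → m M (f i) (vertex k) ≡ fin 3) (sym j≡)
        (labels3 (toℕ i) (≤-pred (≤-pred (subst (_< 2 + len) j≡ (toℕ<n j)))))

      f-far : ∀ i j → 2 + toℕ i ≤ toℕ j → m M (f i) (f j) ≡ fin 2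
      f-far i j 2+i≤j = ¬Adj⇒m≡2
        (λ f≡ → <⇒≢ (≤-trans (n≤1+n _) 2+i≤j) (injective _ _ (bound i) (bound j) f≡))
        (far-apart _ _ 2+i≤j (bound j))

  path-size : ∀ {s t} (P : Path s t) → 2 + Path.len P ≤ n
  path-size P = injective⇒≤ {f = λ (i : Fin (2 + len)) → vertex (toℕ i)}
    λ {i} {j} v≡ → toℕ-injective (injective _ _ (≤-pred (toℕ<n i)) (≤-pred (toℕ<n j)) v≡)
    where open Path P

  path-closing⇒cycle : ∀ {s t} (P : Path s t) j → j < Path.len P →
                       Adj M (Path.last P) (Path.vertex P j) → Cycle
  path-closing⇒cycle P j j<len last~j = record
    { len = L
    ; vertex = λ d → vertex (j + d)
    ; edge = λ d 1+d≤ → subst (λ i → Adj M (vertex i) (vertex (j + d))) (sym (+-suc j d))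
                          (Adj-sym (edge (j + d) (≤-pred (subst (_≤ suc len) (+-suc j d) (within 1+d≤)))))
    ; closing = subst₂ (λ i k → Adj M (vertex i) (vertex k)) (sym (+-identityʳ j)) (sym top≡) (Adj-sym last~j)
    ; injective = λ d e d≤ e≤ v≡ → +-cancelˡ-≡ j d e (injective (j + d) (j + e) (within d≤) (within e≤) v≡)
    }
    where
    open Path P
    L : ℕ
    L = len ∸ suc j
    top≡ : j + (2 + L) ≡ suc len
    top≡ = trans (+-suc j (suc L)) (cong suc (trans (+-suc j L) (m+[n∸m]≡n j<len)))
    within : ∀ {d} → d ≤ 2 + L → j + d ≤ suc len
    within {d} d≤ = subst (j + d ≤_) top≡ (+-monoʳ-≤ j d≤)

  triangle : ∀ {a u u′} → Adj M a u → Adj M a u′ → Adj M u u′ → Cycle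
  triangle {a} {u} {u′} a~u a~u′ u~u′ = record
    { len = 0 ; vertex = vertex ; edge = edge ; closing = a~u′ ; injective = injective }
    where
    vertex : ℕ → Fin n
    vertex zero = a
    vertex (suc zero) = u
    vertex (suc (suc _)) = u′

    edge : ∀ d → suc d ≤ 2 → Adj M (vertex (suc d)) (vertex d)
    edge zero _ = Adj-sym a~u
    edge (suc zero) _ = Adj-sym u~u′
    edge (suc (suc _)) (s≤s (s≤s ()))

    injective : ∀ i j → i ≤ 2 → j ≤ 2 → vertex i ≡ vertex j → i ≡ j
    injective zero zero _ _ _ = refl
    injective zero (suc zero) _ _ a≡u = ⊥-elim (Adj⇒≢ a~u a≡u)
    injective zero (suc (suc zero)) _ _ a≡u′ = ⊥-elim (Adj⇒≢ a~u′ a≡u′)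
    injective (suc zero) zero _ _ u≡a = ⊥-elim (Adj⇒≢ a~u (sym u≡a))
    injective (suc zero) (suc zero) _ _ _ = refl
    injective (suc zero) (suc (suc zero)) _ _ u≡u′ = ⊥-elim (Adj⇒≢ u~u′ u≡u′)
    injective (suc (suc zero)) zero _ _ u′≡a = ⊥-elim (Adj⇒≢ a~u′ (sym u′≡a))
    injective (suc (suc zero)) (suc zero) _ _ u′≡u = ⊥-elim (Adj⇒≢ u~u′ (sym u′≡u))
    injective (suc (suc zero)) (suc (suc zero)) _ _ _ = refl
    injective (suc (suc (suc _))) _ (s≤s (s≤s ())) _ _
    injective _ (suc (suc (suc _))) _ (s≤s (s≤s ())) _

  module Growth {s t} (P : StraightPath s t) where
    open StraightPath P
    open Path path

    Other : Fin n → Set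
    Other u = Adj M last u × u ≢ vertex len

    Other? : ∀ u → Dec (Other u)
    Other? u = Adj? last u ×-dec ¬? (u ≟ᶠ vertex len)

    OnPath : Fin n → Set
    OnPath u = Σ (Fin (2 + len)) λ j → vertex (toℕ j) ≡ u

    onPath? : ∀ u → Dec (OnPath u)
    onPath? u = any? λ j → vertex (toℕ j) ≟ᶠ u

    fresh : ∀ {u} → ¬ OnPath u → ∀ j → j ≤ suc len → vertex j ≢ u
    fresh ¬on j j≤ vj≡u = ¬on (fromℕ< (s≤s j≤) , trans (cong vertex (toℕ-fromℕ< (s≤s j≤))) vj≡u)

    no-other⇒dead-end : ¬ ∃ Other → DeadEnd path
    no-other⇒dead-end none u last~u with u ≟ᶠ vertex len
    ... | yes u≡ = u≡
    ... | no u≢ = ⊥-elim (none (u , last~u , u≢))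

    other-on-path⇒cycle : ∀ {u} → Other u → OnPath u → Cycle
    other-on-path⇒cycle (last~u , u≢) (j , vj≡u) with ≤-suc-cases (≤-pred (toℕ<n j))
    ... | inj₂ j≡ = ⊥-elim (Adj⇒≢ last~u (trans (cong vertex (sym j≡)) vj≡u))
    ... | inj₁ j≤len with m≤n⇒m<n∨m≡n j≤len
    ...   | inj₂ j≡len = ⊥-elim (u≢ (trans (sym vj≡u) (cong vertex j≡len)))
    ...   | inj₁ j<len = path-closing⇒cycle path (toℕ j) j<len (subst (Adj M last) (sym vj≡u) last~u)

    module _ {u} (last~u : Adj M last u) (off : ¬ OnPath u) where
      open Extend path u last~u (fresh off) using (vertex′; old; new) renaming (path to extended)

      branch-arm : ∀ {u′} → Other u′ → ¬ 𝒞 M u u′ → Arm s t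
      branch-arm {u′} (last~u′ , u′≢) u≁u′ = record
        { path = extended
        ; end = detour u′ ( subst (λ v → Adj M v u′) (sym (old ≤-refl)) last~u′
                          , subst (λ v → ¬ 𝒞 M v u′) (sym new) u≁u′
                          , (λ u′≡ → u′≢ (trans u′≡ (old (n≤1+n len))))
                          , s≤s z≤n )
        }

      reflect-arm : m M last u ≢ fin 3 → Arm s t
      reflect-arm m≢3 = record
        { path = extended
        ; end = reflect λ m≡3 → m≢3 (trans (sym (cong₂ (m M) (old ≤-refl) new)) m≡3)
        }

      extend-straight : m M last u ≡ fin 3 → (∀ w → Other w → w ≡ u) → StraightPath s t
      extend-straight m≡3 only-u = record
        { path = extended
        ; labels3 = labels3′
        ; inner-degree-2 = inner-degree-2′
        }
        where
        labels3′ : ∀ j → j ≤ suc len → m M (vertex′ j) (vertex′ (suc j)) ≡ fin 3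
        labels3′ j j≤ with ≤-suc-cases j≤
        ... | inj₁ j≤len = trans (cong₂ (m M) (old (≤-trans j≤len (n≤1+n _))) (old (s≤s j≤len))) (labels3 j j≤len)
        ... | inj₂ refl = trans (cong₂ (m M) (old ≤-refl) new) m≡3

        inner-degree-2′ : ∀ l → suc l ≤ suc len → ∀ w → Adj M (vertex′ (suc l)) w →
                          w ≡ vertex′ l ⊎ w ≡ vertex′ (2 + l)
        inner-degree-2′ l 1+l≤ w v~w with ≤-suc-cases 1+l≤
        ... | inj₁ l<len with inner-degree-2 l l<len w (subst (λ v → Adj M v w) (old (≤-trans l<len (n≤1+n _))) v~w)
        ...   | inj₁ w≡ = inj₁ (trans w≡ (sym (old (≤-trans (n≤1+n l) (≤-trans l<len (n≤1+n _))))))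
        ...   | inj₂ w≡ = inj₂ (trans w≡ (sym (old (s≤s l<len))))
        inner-degree-2′ l 1+l≤ w v~w | inj₂ refl with w ≟ᶠ vertex len
        ... | yes w≡ = inj₁ (trans w≡ (sym (old (n≤1+n len))))
        ... | no w≢ = inj₂ (trans (only-u w (subst (λ v → Adj M v w) (old ≤-refl) v~w , w≢)) (sym new))

    two-others : ∀ {u u′} → Other u → ¬ OnPath u → Other u′ → u′ ≢ u → Cycle ⊎ Arm s t
    two-others {u} {u′} other@(last~u , _) off other′@(last~u′ , _) u′≢u with onPath? u′ | 𝒞? u u′
    ... | yes on′ | _ = inj₁ (other-on-path⇒cycle other′ on′)
    ... | no _ | yes c = inj₁ (triangle last~u last~u′ (𝒞∧≢⇒Adj c (u′≢u ∘ sym)))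
    ... | no _ | no u≁u′ = inj₂ (branch-arm last~u off other′ u≁u′)

    Longer : Set
    Longer = Σ (StraightPath s t) λ P′ → Path.len (StraightPath.path P′) ≡ suc len

    advance : ¬ TypeA M (Γ→ M s t) → (Cycle ⊎ Arm s t) ⊎ Longer
    advance ¬A with any? Other?
    ... | no none = ⊥-elim (¬A (DeadEndPath.typeA P (no-other⇒dead-end none)))
    ... | yes (u , other) with onPath? u
    ...   | yes on = inj₁ (inj₁ (other-on-path⇒cycle other on))
    ...   | no off with any? (λ u′ → Other? u′ ×-dec ¬? (u′ ≟ᶠ u))
    ...     | yes (u′ , other′ , u′≢u) = inj₁ (two-others other off other′ u′≢u)
    ...     | no unique with m M last u ≟ᴸ fin 3
    ...       | no m≢3 = inj₁ (inj₂ (reflect-arm (proj₁ other) off m≢3))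
    ...       | yes m≡3 = inj₂ (extend-straight (proj₁ other) off m≡3 only-u , refl)
      where
      only-u : ∀ w → Other w → w ≡ u
      only-u w other-w with w ≟ᶠ u
      ... | yes w≡u = w≡u
      ... | no w≢u = ⊥-elim (unique (w , other-w , w≢u))

  -- The fuel bounds the number of extensions: a path visits at most n vertices.
  grow : ∀ {s t} → ¬ TypeA M (Γ→ M s t) → ∀ fuel (P : StraightPath s t) →
         n ≤ fuel + suc (Path.len (StraightPath.path P)) → Cycle ⊎ Arm s t
  grow ¬A zero P n≤ = ⊥-elim (1+n≰n (≤-trans (path-size (StraightPath.path P)) n≤))
  grow ¬A (suc fuel) P n≤ with Growth.advance P ¬A
  ... | inj₁ outcome = outcome
  ... | inj₂ (P′ , len≡) =
    grow ¬A fuel P′ (subst (λ l → n ≤ fuel + suc l) (sym len≡) (subst (n ≤_) (sym (+-suc fuel _)) n≤))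

  edge-path : ∀ {s t} → Adj M s t → Path s t
  edge-path {s} {t} s~t = record
    { len = 0 ; vertex = vertex ; starts = refl ; second = refl ; edge = λ { zero _ → s~t } ; injective = injective }
    where
    vertex : ℕ → Fin n
    vertex zero = s
    vertex (suc _) = t

    injective : ∀ i j → i ≤ 1 → j ≤ 1 → vertex i ≡ vertex j → i ≡ j
    injective zero zero _ _ _ = refl
    injective zero (suc zero) _ _ s≡t = ⊥-elim (Adj⇒≢ s~t s≡t)
    injective (suc zero) zero _ _ t≡s = ⊥-elim (Adj⇒≢ s~t (sym t≡s))
    injective (suc zero) (suc zero) _ _ _ = refl
    injective (suc (suc _)) _ (s≤s ()) _ _
    injective _ (suc (suc _)) _ (s≤s ()) _

  non-typeA⇒cycle-or-arm : ∀ {s t} → Adj M s t → ¬ TypeA M (Γ→ M s t) → Cycle ⊎ Arm s t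
  non-typeA⇒cycle-or-arm {s} {t} s~t ¬A with m M s t ≟ᴸ fin 3
  ... | no m≢3 = inj₂ (record { path = edge-path s~t ; end = reflect m≢3 })
  ... | yes m≡3 = grow ¬A n straight (m≤m+n n 1)
    where
    straight : StraightPath s t
    straight = record
      { path = edge-path s~t ; labels3 = λ { zero _ → m≡3 } ; inner-degree-2 = λ _ () }

  turn-along : ∀ {track track′ span span′} → track′ 0 ≡ track 0 → track′ 1 ≡ track 1 →
               (1 ≤ span → track′ 2 ≡ track 2) → span ≤ span′ → Turn track span → Turn track′ span′
  turn-along e₀ e₁ _ _ (reflect m≢3) =
    reflect λ m≡3 → m≢3 (trans (sym (cong₂ (m M) e₁ e₀)) m≡3)
  turn-along e₀ e₁ e₂ span≤ (detour x (adj , commutes , x≢ , 1≤span)) =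
    detour x ( subst (λ v → Adj M v x) (sym e₁) adj
             , subst (λ v → ¬ 𝒞 M v x) (sym e₀) commutes
             , (λ x≡ → x≢ (trans x≡ (e₂ 1≤span)))
             , ≤-trans 1≤span span≤ )

  route : (ℕ → Fin n) → ℕ → (ℕ → Fin n) → ℕ → Fin n
  route u K v d with d ≤? K
  ... | yes _ = u (K ∸ d)
  ... | no _ = v (d ∸ K)

  route-≤ : ∀ u K v {d} → d ≤ K → route u K v d ≡ u (K ∸ d)
  route-≤ u K v {d} d≤K with d ≤? K
  ... | yes _ = refl
  ... | no d≰K = ⊥-elim (d≰K d≤K)

  route-left : ∀ u K v d j → d + j ≡ K → route u K v d ≡ u j
  route-left u K v d j d+j≡K =
    trans (route-≤ u K v (subst (d ≤_) d+j≡K (m≤m+n d j))) (cong u (trans (cong (_∸ d) (sym d+j≡K)) (m+n∸m≡n d j)))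

  route-right : ∀ u K v d j → K + j ≡ d → u 0 ≡ v 0 → route u K v d ≡ v j
  route-right u K v d j K+j≡d u₀≡v₀ with d ≤? K
  ... | no _ = cong v (trans (cong (_∸ K) (sym K+j≡d)) (m+n∸m≡n K j))
  ... | yes d≤K with j
  ...   | zero = trans (cong u (trans (cong (K ∸_) (sym (trans (sym (+-identityʳ K)) K+j≡d))) (n∸n≡0 K))) u₀≡v₀
  ...   | suc j′ = ⊥-elim (<⇒≱ (subst (K <_) K+j≡d (m<m+n K (s≤s z≤n))) d≤K)

  route-split : ∀ d K → (∃ λ j → d + j ≡ K) ⊎ (∃ λ j → K + suc j ≡ d)
  route-split d K with d ≤? K
  ... | yes d≤K = inj₁ (K ∸ d , m+[n∸m]≡n d≤K)
  ... | no d≰K = inj₂ (d ∸ suc K , trans (+-suc K _) (m+[n∸m]≡n (≰⇒> d≰K)))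

  module Route {s t₁ t₂} (A : Path s t₁) (B : Path s t₂) where
    private
      module A = Path A
      module B = Path B

    K K′ : ℕ
    K = suc A.len
    K′ = suc B.len

    shared-start : A.vertex 0 ≡ B.vertex 0
    shared-start = trans A.starts (sym B.starts)

    track : ℕ → Fin n
    track = route A.vertex K B.vertex

    track-end : ∀ {d} → d ≤ K → track d ≡ A.reversed d
    track-end = route-≤ A.vertex K B.vertex

    track-edge : ∀ d → suc d ≤ K + K′ → Adj M (track (suc d)) (track d)
    track-edge d 1+d≤ with route-split (suc d) K
    ... | inj₁ (j , e) =
      subst₂ (Adj M) (sym (route-left A.vertex K B.vertex (suc d) j e))
                     (sym (route-left A.vertex K B.vertex d (suc j) (trans (+-suc d j) e)))
                     (A.edge j (subst (j ≤_) (suc-injective e) (m≤n+m j d)))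
    ... | inj₂ (j , e) =
      subst₂ (Adj M) (sym (route-right A.vertex K B.vertex (suc d) (suc j) e shared-start))
                     (sym (route-right A.vertex K B.vertex d j (suc-injective (trans (sym (+-suc K j)) e)) shared-start))
                     (Adj-sym (B.edge j (≤-pred (+-cancelˡ-≤ K (suc j) K′ (subst (_≤ K + K′) (sym e) 1+d≤)))))

    track-distinct₂ : t₁ ≢ t₂ → ∀ d → 2 + d ≤ K + K′ → track d ≢ track (2 + d)
    track-distinct₂ t₁≢t₂ d 2+d≤ d≡ with route-split (2 + d) K
    ... | inj₁ (j , e) = m≢1+n+m j {1} (sym (A.injective (2 + j) j 2+j≤ (≤-trans (n≤1+n j) (≤-trans (n≤1+n _) 2+j≤))
          (trans (sym (route-left A.vertex K B.vertex d (2 + j) d+2+j≡))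
                 (trans d≡ (route-left A.vertex K B.vertex (2 + d) j e)))))
      where
      d+2+j≡ : d + (2 + j) ≡ K
      d+2+j≡ = trans (+-suc d (suc j)) (trans (cong suc (+-suc d j)) e)
      2+j≤ : 2 + j ≤ K
      2+j≤ = subst (2 + j ≤_) (trans (+-comm (2 + j) d) d+2+j≡) (m≤m+n (2 + j) d)
    ... | inj₂ (zero , e) = t₁≢t₂ (trans (sym A.second) (trans (sym (route-left A.vertex K B.vertex d 1 d+1≡))
          (trans d≡ (trans (route-right A.vertex K B.vertex (2 + d) 1 e shared-start) B.second))))
      where
      d+1≡ : d + 1 ≡ K
      d+1≡ = trans (+-comm d 1) (sym (suc-injective (trans (sym (+-comm K 1)) e)))
    ... | inj₂ (suc j , e) = m≢1+n+m j {1} (B.injective j (2 + j) (≤-trans (n≤1+n j) (≤-trans (n≤1+n _) 2+j≤)) 2+j≤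
          (trans (sym (route-right A.vertex K B.vertex d j K+j≡ shared-start))
                 (trans d≡ (route-right A.vertex K B.vertex (2 + d) (2 + j) e shared-start))))
      where
      K+j≡ : K + j ≡ d
      K+j≡ = suc-injective (suc-injective (trans (sym (trans (+-suc K (suc j)) (cong suc (+-suc K j)))) e))
      2+j≤ : 2 + j ≤ K′
      2+j≤ = +-cancelˡ-≤ K (2 + j) K′ (subst (_≤ K + K′) (sym e) 2+d≤)

    track-reverse : ∀ d e → d + e ≡ K + K′ → route B.vertex K′ A.vertex d ≡ track e
    track-reverse d e d+e≡ with route-split d K′
    ... | inj₁ (j , d+j≡) =
      trans (route-left B.vertex K′ A.vertex d j d+j≡) (sym (route-right A.vertex K B.vertex e j K+j≡e shared-start))
      where
      K+j≡e : K + j ≡ e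
      K+j≡e = +-cancelˡ-≡ d (K + j) e (begin
        d + (K + j)  ≡⟨ sym (+-assoc d K j) ⟩
        d + K + j    ≡⟨ cong (_+ j) (+-comm d K) ⟩
        K + d + j    ≡⟨ +-assoc K d j ⟩
        K + (d + j)  ≡⟨ cong (K +_) d+j≡ ⟩
        K + K′       ≡⟨ sym d+e≡ ⟩
        d + e        ∎)
        where open ≡-Reasoning
    ... | inj₂ (j , K′+1+j≡d) =
      trans (route-right B.vertex K′ A.vertex d (suc j) K′+1+j≡d (sym shared-start))
            (sym (route-left A.vertex K B.vertex e (suc j) e+1+j≡))
      where
      e+1+j≡ : e + suc j ≡ K
      e+1+j≡ = +-cancelʳ-≡ K′ (e + suc j) K
        (trans (+-assoc e (suc j) K′) (trans (cong (e +_) (+-comm (suc j) K′))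
          (trans (cong (e +_) K′+1+j≡d) (trans (+-comm e d) d+e≡))))

  two-arms⇒shuttle : ∀ {s t₁ t₂} → t₁ ≢ t₂ → Arm s t₁ → Arm s t₂ → Shuttle
  two-arms⇒shuttle t₁≢t₂ A B = record
    { span = a + b
    ; track = track
    ; track-edge = track-edge
    ; track-distinct₂ = track-distinct₂
    ; track-reverse = track-reverse
    ; turn = turn
    }
    where
    a b : ℕ
    a = Path.len (Arm.path A)
    b = Path.len (Arm.path B)

    module AB = Route (Arm.path A) (Arm.path B)
    module BA = Route (Arm.path B) (Arm.path A)

    AB-total : AB.K + AB.K′ ≡ 2 + (a + b)
    AB-total = cong suc (+-suc a b)

    BA-total : BA.K + BA.K′ ≡ 2 + (a + b)
    BA-total = trans (cong suc (+-suc b a)) (cong (2 +_) (+-comm b a))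

    track : Bool → ℕ → Fin n
    track false = AB.track
    track true = BA.track

    track-edge : ∀ c d → suc d ≤ 2 + (a + b) → Adj M (track c (suc d)) (track c d)
    track-edge false d d< = AB.track-edge d (subst (suc d ≤_) (sym AB-total) d<)
    track-edge true d d< = BA.track-edge d (subst (suc d ≤_) (sym BA-total) d<)

    track-distinct₂ : ∀ c d → 2 + d ≤ 2 + (a + b) → track c d ≢ track c (2 + d)
    track-distinct₂ false d d< = AB.track-distinct₂ t₁≢t₂ d (subst (2 + d ≤_) (sym AB-total) d<)
    track-distinct₂ true d d< = BA.track-distinct₂ (t₁≢t₂ ∘ sym) d (subst (2 + d ≤_) (sym BA-total) d<)

    track-reverse : ∀ c d e → d + e ≡ 2 + (a + b) → track (not c) d ≡ track c e
    track-reverse false d e d+e≡ = AB.track-reverse d e (trans d+e≡ (sym AB-total))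
    track-reverse true d e d+e≡ = BA.track-reverse d e (trans d+e≡ (sym BA-total))

    turn : ∀ c → Turn (track c) (a + b)
    turn false = turn-along (AB.track-end z≤n) (AB.track-end (s≤s z≤n)) (λ 1≤a → AB.track-end (s≤s 1≤a))
                            (m≤m+n a b) (Arm.end A)
    turn true = turn-along (BA.track-end z≤n) (BA.track-end (s≤s z≤n)) (λ 1≤b → BA.track-end (s≤s 1≤b))
                           (m≤n+m b a) (Arm.end B)

lemma3p3p3 : ∀ {n : ℕ} (M : CoxeterMatrix n) → FCFinite M →
    (s : Fin n) → 1 < degree M s →
    (t₁ t₂ : Fin n) → Adj M s t₁ → Adj M s t₂ →
    ¬ TypeA M (Γ→ M s t₁) → ¬ TypeA M (Γ→ M s t₂) → t₁ ≡ t₂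
lemma3p3p3 M fc s _ t₁ t₂ s~t₁ s~t₂ ¬A₁ ¬A₂ with t₁ ≟ᶠ t₂
... | yes t₁≡t₂ = t₁≡t₂
... | no t₁≢t₂ with non-typeA⇒cycle-or-arm M s~t₁ ¬A₁ | non-typeA⇒cycle-or-arm M s~t₂ ¬A₂
...   | inj₁ C | _ = ⊥-elim (cycle⇒¬FCFinite M C fc)
...   | inj₂ _ | inj₁ C = ⊥-elim (cycle⇒¬FCFinite M C fc)
...   | inj₂ A₁ | inj₂ A₂ = ⊥-elim (shuttle⇒¬FCFinite M (two-arms⇒shuttle M t₁≢t₂ A₁ A₂) fc)
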